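{- If $G$ is a connected graph, then $$W_{def}(G)\leq 1+def(G)+\max_{P\in \mathbf{P}}\sum_{v\in V(P)}\left(d_{G}(v)-1\right),$$ where $\mathbf{P}$ is the set of all shortest paths in $G$ (paths whose length equals the distance in $G$ between their endpoints) and $d_G(v)$ is the degree of $v$.
   Context: All graphs are finite, undirected, without loops or multiple edges. A proper $t$-edge-coloring of $G$ is a map $\alpha:E(G)\to\{1,\ldots,t\}$ such that all $t$ colors are used and adjacent edges receive different colors. The spectrum $S(v,\alpha)$ of a vertex $v$ is the set of colors on edges incident to $v$. For a finite set $A$ of integers, $def(A)=\max A-\min A-|A|+1$ ($def(\emptyset)=0$). Define $def(v,\alpha)=def(S(v,\alpha))$, $def(G,\alpha)=\sum_{v\in V(G)}def(v,\alpha)$, and $def(G)=\min_\alpha def(G,\alpha)$ over all proper edge-colorings $\alpha$ of $G$. $W_{def}(G)$ is the largest $t$ such that $G$ has a proper $t$-edge-coloring $\alpha$ with $def(G,\alpha)=def(G)$. -}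

module Defs where

open import Data.Nat using (ℕ; zero; suc; _+_; _∸_; _≤_; _⊔_; _⊓_)
open import Data.Nat.Properties using (_≟_)
open import Data.Integer as ℤ using (ℤ; +_)
open import Data.Bool using (Bool; true; false; T)
open import Data.Fin using (Fin)
import Data.Fin.Properties as FinP
open import Data.List using (List; []; _∷_; length; filter; map; foldr; deduplicate)
open import Data.Nat.ListAction using (sum)
open import Data.List.Relation.Unary.Unique.Propositional using (Unique)
open import Data.Product using (Σ; ∃; _×_; _,_)
open import Data.Unit using (⊤)
open import Relation.Binary.PropositionalEquality using (_≡_; _≢_)
open import Relation.Nullary.Decidable using (T?)

record Graph : Set where
  field
    n     : ℕ
    adj   : Fin n → Fin n → Bool
    sym   : ∀ u v → adj u v ≡ adj v u
    loopless : ∀ v → adj v v ≡ false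
open Graph public

Edge : (G : Graph) → Fin (n G) → Fin (n G) → Set
Edge G u v = T (adj G u v)

neighbours : (G : Graph) → Fin (n G) → List (Fin (n G))
neighbours G v = filter (λ u → T? (adj G v u)) (Data.List.allFin (n G))

degree : (G : Graph) → Fin (n G) → ℕ
degree G v = length (neighbours G v)

-- A proper t-edge-colouring: the colour of edge uv is α u v (= α v u);
-- colours lie in {1..t}, all t colours are used, adjacent edges differ.
-- (Values of α on non-edges are irrelevant.)
record ProperColouring (G : Graph) (t : ℕ) (α : Fin (n G) → Fin (n G) → ℕ) : Set where
  field
    symm    : ∀ u v → Edge G u v → α u v ≡ α v u
    inRange : ∀ u v → Edge G u v → 1 ≤ α u v × α u v ≤ t
    allUsed : ∀ k → 1 ≤ k → k ≤ t → ∃ λ u → ∃ λ v → Edge G u v × α u v ≡ k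
    proper  : ∀ v u w → Edge G v u → Edge G v w → u ≢ w → α v u ≢ α v w

-- spectrum S(v, α), as a list (the set is its set of elements)
spectrum : (G : Graph) → (Fin (n G) → Fin (n G) → ℕ) → Fin (n G) → List ℕ
spectrum G α v = map (α v) (neighbours G v)

-- def(A) = max A − min A − |A| + 1, def(∅) = 0, for a finite set A given as a list
-- (|A| = number of distinct elements).
defL : List ℕ → ℕ
defL [] = 0
defL (x ∷ xs) = (suc (foldr _⊔_ x xs) ∸ foldr _⊓_ x xs) ∸ length (deduplicate _≟_ (x ∷ xs))

defV : (G : Graph) → (Fin (n G) → Fin (n G) → ℕ) → Fin (n G) → ℕ
defV G α v = defL (spectrum G α v)

defG : (G : Graph) → (Fin (n G) → Fin (n G) → ℕ) → ℕ
defG G α = sum (map (defV G α) (Data.List.allFin (n G)))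

IsDef : Graph → ℕ → Set
IsDef G d =
  (∃ λ t → ∃ λ α → ProperColouring G t α × defG G α ≡ d) ×
  (∀ t α → ProperColouring G t α → d ≤ defG G α)

-- paths: a path from u is given by u and the list of remaining vertices
AdjChain : (G : Graph) → Fin (n G) → List (Fin (n G)) → Set
AdjChain G x [] = ⊤
AdjChain G x (y ∷ ys) = Edge G x y × AdjChain G y ys

lastOf : {A : Set} → A → List A → A
lastOf x [] = x
lastOf x (y ∷ ys) = lastOf y ys

-- the vertex sequence u ∷ rest is a path from u to v (distinct vertices, consecutive adjacent);
-- its length is length rest
IsPath : (G : Graph) → Fin (n G) → Fin (n G) → List (Fin (n G)) → Set
IsPath G u v rest = AdjChain G u rest × Unique (u ∷ rest) × lastOf u rest ≡ v

IsShortestPath : (G : Graph) → Fin (n G) → Fin (n G) → List (Fin (n G)) → Set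
IsShortestPath G u v rest =
  IsPath G u v rest × (∀ rest' → IsPath G u v rest' → length rest ≤ length rest')

Connected : Graph → Set
Connected G = 1 ≤ n G × (∀ u v → ∃ λ rest → IsPath G u v rest)

pathWeight : (G : Graph) → Fin (n G) → List (Fin (n G)) → ℤ
pathWeight G u rest = sum' (map (λ v → + degree G v ℤ.- + 1) (u ∷ rest))
  where
  sum' : List ℤ → ℤ
  sum' = foldr ℤ._+_ (+ 0)

-- Take an edge coloured 1 and an edge coloured t, and a shortest path P from an end of
-- the first to an end of the second. Any two colours at a vertex v differ by at most
-- def(v, α) + d(v) − 1, because the spectrum spans def(v, α) + |S(v, α)| consecutive
-- values. Walking along P the colour thus rises from 1 to t by at most
-- Σ_{v ∈ P} (def(v, α) + d(v) − 1) ≤ def(G, α) + Σ_{v ∈ P} (d(v) − 1).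
module Submission where

open import Defs
open import Data.Nat using (ℕ)
open import Data.Integer using (+_; _+_; _≤_)
open import Data.Fin using (Fin)
open import Data.List using (List)
open import Data.Product using (∃; _×_)
open import Relation.Binary.PropositionalEquality using (_≡_)

open import Data.Nat as ℕ using (zero; suc; _∸_; _⊔_; _⊓_; z≤n; s≤s)
import Data.Nat.Properties as ℕ
import Data.Integer as ℤ
import Data.Integer.Properties as ℤ
open import Algebra.Properties.CommutativeSemigroup ℕ.+-commutativeSemigroup
  using (interchange; x∙yz≈y∙xz)
open import Data.Integer.Tactic.RingSolver using (solve-∀)
open import Data.Fin as Fin using (fromℕ<)
import Data.Fin.Properties as Fin
open import Data.List using ([]; _∷_; length; map; foldr; deduplicate; _++_)
open import Data.List.Properties using (foldr-preservesᵒ; length-deduplicate; length-map; map-++)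
open import Data.Nat.ListAction using (sum)
open import Data.Nat.ListAction.Properties using (sum-++)
open import Data.List.Relation.Unary.Any as Any using (Any; here; there)
import Data.List.Relation.Unary.All as All
open import Data.List.Relation.Unary.AllPairs using ([]; _∷_)
open import Data.List.Relation.Unary.Unique.Propositional using (Unique)
import Data.List.Relation.Unary.Unique.DecPropositional as Unique
open import Data.List.Relation.Binary.Subset.Propositional using (_⊆_)
open import Data.List.Membership.Propositional using (_∈_)
open import Data.List.Membership.Propositional.Properties
  using (∈-map⁺; ∈-filter⁺; ∈-allFin; ∈-∃++; ∈-++⁻; ∈-++⁺ˡ; ∈-++⁺ʳ)
open import Data.Product using (Σ; _,_; proj₂)
open import Data.Sum using (_⊎_; inj₁; inj₂)
open import Data.Unit using (tt)
open import Data.Empty using (⊥-elim)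
open import Data.Bool using (T)
open import Relation.Binary.PropositionalEquality
  using (refl; trans; cong; cong₂; subst; subst₂; module ≡-Reasoning)
import Relation.Binary.PropositionalEquality as ≡
open import Relation.Nullary using (Dec; yes; no)
open import Relation.Nullary.Decidable using (T?; _×-dec_)
open import Function using (_∘_)

private
  variable
    A : Set

≤-foldr-⊔ : ∀ {y} x xs → y ∈ x ∷ xs → y ℕ.≤ foldr _⊔_ x xs
≤-foldr-⊔ {y} x xs y∈ = foldr-preservesᵒ pres x xs (split y∈)
  where
  pres : ∀ a b → y ℕ.≤ a ⊎ y ℕ.≤ b → y ℕ.≤ a ⊔ b
  pres a b (inj₁ y≤a) = ℕ.m≤n⇒m≤n⊔o b y≤a
  pres a b (inj₂ y≤b) = ℕ.m≤n⇒m≤o⊔n a y≤b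
  split : y ∈ x ∷ xs → y ℕ.≤ x ⊎ Any (y ℕ.≤_) xs
  split (here refl) = inj₁ ℕ.≤-refl
  split (there y∈xs) = inj₂ (Any.map (λ { refl → ℕ.≤-refl }) y∈xs)

foldr-⊓-≤ : ∀ {y} x xs → y ∈ x ∷ xs → foldr _⊓_ x xs ℕ.≤ y
foldr-⊓-≤ {y} x xs y∈ = foldr-preservesᵒ pres x xs (split y∈)
  where
  pres : ∀ a b → a ℕ.≤ y ⊎ b ℕ.≤ y → a ⊓ b ℕ.≤ y
  pres a b (inj₁ a≤y) = ℕ.m≤n⇒m⊓o≤n b a≤y
  pres a b (inj₂ b≤y) = ℕ.m≤n⇒o⊓m≤n a b≤y
  split : y ∈ x ∷ xs → x ℕ.≤ y ⊎ Any (ℕ._≤ y) xs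
  split (here refl) = inj₁ ℕ.≤-refl
  split (there y∈xs) = inj₂ (Any.map (λ { refl → ℕ.≤-refl }) y∈xs)

-- max A − min A + 1 = defL + |A|, and |A| is at most the length of the list.
∈⇒≤+defL+length : ∀ {a b} ys → a ∈ ys → b ∈ ys → b ℕ.+ 1 ℕ.≤ a ℕ.+ (defL ys ℕ.+ length ys)
∈⇒≤+defL+length {a} {b} (x ∷ xs) a∈ b∈ = begin
  b ℕ.+ 1                          ≡⟨ ℕ.+-comm b 1 ⟩
  suc b                            ≤⟨ s≤s (≤-foldr-⊔ x xs b∈) ⟩
  suc max                          ≤⟨ ℕ.m≤n+m∸n (suc max) min ⟩
  min ℕ.+ (suc max ∸ min)          ≤⟨ ℕ.+-mono-≤ (foldr-⊓-≤ x xs a∈) (ℕ.m≤n+m∸n (suc max ∸ min) size) ⟩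
  a ℕ.+ (size ℕ.+ defL (x ∷ xs))   ≡⟨ cong (a ℕ.+_) (ℕ.+-comm size _) ⟩
  a ℕ.+ (defL (x ∷ xs) ℕ.+ size)   ≤⟨ ℕ.+-monoʳ-≤ a (ℕ.+-monoʳ-≤ (defL (x ∷ xs)) (length-deduplicate ℕ._≟_ (x ∷ xs))) ⟩
  a ℕ.+ (defL (x ∷ xs) ℕ.+ length (x ∷ xs)) ∎
  where
  open ℕ.≤-Reasoning
  max = foldr _⊔_ x xs
  min = foldr _⊓_ x xs
  size = length (deduplicate ℕ._≟_ (x ∷ xs))

sum-map-+ : (f g : A → ℕ) (xs : List A) →
  sum (map (λ x → f x ℕ.+ g x) xs) ≡ sum (map f xs) ℕ.+ sum (map g xs)
sum-map-+ f g [] = refl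
sum-map-+ f g (x ∷ xs) =
  trans (cong ((f x ℕ.+ g x) ℕ.+_) (sum-map-+ f g xs)) (interchange (f x) (g x) _ _)

sum-map-++ : (f : A → ℕ) (xs ys : List A) →
  sum (map f (xs ++ ys)) ≡ sum (map f xs) ℕ.+ sum (map f ys)
sum-map-++ f xs ys = trans (cong sum (map-++ f xs ys)) (sum-++ (map f xs) (map f ys))

sum-map-mono-⊆ : (f : A → ℕ) {xs ys : List A} → Unique xs → xs ⊆ ys →
  sum (map f xs) ℕ.≤ sum (map f ys)
sum-map-mono-⊆ f {[]} _ _ = z≤n
sum-map-mono-⊆ f {x ∷ xs} (x∉xs ∷ unique) xs⊆ys with ∈-∃++ (xs⊆ys (here refl))
... | ys₁ , ys₂ , refl = begin
  f x ℕ.+ sum (map f xs)                            ≤⟨ ℕ.+-monoʳ-≤ (f x) (sum-map-mono-⊆ f unique xs⊆ys₁++ys₂) ⟩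
  f x ℕ.+ sum (map f (ys₁ ++ ys₂))                  ≡⟨ cong (f x ℕ.+_) (sum-map-++ f ys₁ ys₂) ⟩
  f x ℕ.+ (sum (map f ys₁) ℕ.+ sum (map f ys₂))     ≡⟨ x∙yz≈y∙xz (f x) (sum (map f ys₁)) (sum (map f ys₂)) ⟩
  sum (map f ys₁) ℕ.+ (f x ℕ.+ sum (map f ys₂))     ≡⟨ ≡.sym (sum-map-++ f ys₁ (x ∷ ys₂)) ⟩
  sum (map f (ys₁ ++ x ∷ ys₂)) ∎
  where
  open ℕ.≤-Reasoning
  xs⊆ys₁++ys₂ : xs ⊆ ys₁ ++ ys₂
  xs⊆ys₁++ys₂ z∈xs with ∈-++⁻ ys₁ (xs⊆ys (there z∈xs))
  ... | inj₁ z∈ys₁ = ∈-++⁺ˡ z∈ys₁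
  ... | inj₂ (here refl) = ⊥-elim (All.lookup x∉xs z∈xs refl)
  ... | inj₂ (there z∈ys₂) = ∈-++⁺ʳ ys₁ z∈ys₂

least-witness : (P : ℕ → Set) → (∀ k → Dec (P k)) → ∀ {m} → P m →
  Σ ℕ λ j → P j × (∀ i → P i → j ℕ.≤ i)
least-witness P P? {zero} p = 0 , p , λ _ _ → z≤n
least-witness P P? {suc m} p with P? 0
... | yes p₀ = 0 , p₀ , λ _ _ → z≤n
... | no ¬p₀ with least-witness (P ∘ suc) (P? ∘ suc) p
...   | j , pj , j-least = suc j , pj , λ { zero p₀ → ⊥-elim (¬p₀ p₀) ; (suc i) pi → s≤s (j-least i pi) }

any-of-length? : ∀ {N} k (P : List (Fin N) → Set) → (∀ xs → Dec (P xs)) →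
  Dec (Σ (List (Fin N)) λ xs → length xs ≡ k × P xs)
any-of-length? zero P P? with P? []
... | yes p = yes ([] , refl , p)
... | no ¬p = no λ { ([] , _ , p) → ¬p p }
any-of-length? (suc k) P P?
  with Fin.any? (λ x → any-of-length? k (P ∘ (x ∷_)) (P? ∘ (x ∷_)))
... | yes (x , xs , refl , p) = yes (x ∷ xs , refl , p)
... | no ¬p = no λ { ((x ∷ xs) , refl , p) → ¬p (x , xs , refl , p) }

module _ (G : Graph) where

  adjChain? : ∀ x rest → Dec (AdjChain G x rest)
  adjChain? x [] = yes tt
  adjChain? x (y ∷ ys) = T? (adj G x y) ×-dec adjChain? y ys

  isPath? : ∀ u v rest → Dec (IsPath G u v rest)
  isPath? u v rest =
    adjChain? u rest ×-dec Unique.unique? Fin._≟_ (u ∷ rest) ×-dec (lastOf u rest Fin.≟ v)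

  path⇒shortestPath : ∀ {u v rest} → IsPath G u v rest → ∃ λ rest′ → IsShortestPath G u v rest′
  path⇒shortestPath {u} {v} {rest} p
    with least-witness (λ k → Σ _ λ r → length r ≡ k × IsPath G u v r)
                       (λ k → any-of-length? k (IsPath G u v) (isPath? u v)) (rest , refl , p)
  ... | _ , (r , refl , pr) , least = r , pr , λ r′ pr′ → least (length r′) (r′ , refl , pr′)

Edge-sym : (G : Graph) {u v : Fin (n G)} → Edge G u v → Edge G v u
Edge-sym G {u} {v} = subst T (Graph.sym G u v)

module _ (G : Graph) {t : ℕ} {α : Fin (n G) → Fin (n G) → ℕ} (α-proper : ProperColouring G t α) where

  open ProperColouring α-proper using (symm)

  slack : Fin (n G) → ℕ
  slack v = defV G α v ℕ.+ degree G v

  colour∈spectrum : ∀ {v w} → Edge G v w → α v w ∈ spectrum G α v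
  colour∈spectrum {v} {w} e = ∈-map⁺ (α v) (∈-filter⁺ (λ u → T? (adj G v u)) (∈-allFin w) e)

  colour-gap-at : ∀ {v w₁ w₂} → Edge G v w₁ → Edge G v w₂ → α v w₂ ℕ.+ 1 ℕ.≤ α v w₁ ℕ.+ slack v
  colour-gap-at {v} e₁ e₂ =
    subst (λ l → α v _ ℕ.+ 1 ℕ.≤ α v _ ℕ.+ (defV G α v ℕ.+ l)) (length-map (α v) (neighbours G v))
      (∈⇒≤+defL+length (spectrum G α v) (colour∈spectrum e₁) (colour∈spectrum e₂))

  colour-gap-along : ∀ x rest → AdjChain G x rest → ∀ {w₁ w₂} →
    Edge G x w₁ → Edge G (lastOf x rest) w₂ →
    α (lastOf x rest) w₂ ℕ.+ length (x ∷ rest) ℕ.≤ α x w₁ ℕ.+ sum (map slack (x ∷ rest))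
  colour-gap-along x [] _ {w₁} {w₂} e₁ e₂ =
    subst (λ s → α x w₂ ℕ.+ 1 ℕ.≤ α x w₁ ℕ.+ s) (≡.sym (ℕ.+-identityʳ (slack x))) (colour-gap-at e₁ e₂)
  colour-gap-along x (y ∷ ys) (exy , chain) {w₁} {w₂} e₁ e₂ = begin
    α z w₂ ℕ.+ suc (length (y ∷ ys))  ≡⟨ ℕ.+-suc (α z w₂) _ ⟩
    suc (α z w₂ ℕ.+ length (y ∷ ys))  ≤⟨ s≤s (colour-gap-along y ys chain (Edge-sym G exy) e₂) ⟩
    suc (α y x ℕ.+ S)                 ≡⟨ cong (ℕ._+ S) (trans (cong suc (symm y x (Edge-sym G exy))) (ℕ.+-comm 1 (α x y))) ⟩
    (α x y ℕ.+ 1) ℕ.+ S               ≤⟨ ℕ.+-monoˡ-≤ S (colour-gap-at e₁ exy) ⟩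
    (α x w₁ ℕ.+ slack x) ℕ.+ S        ≡⟨ ℕ.+-assoc (α x w₁) (slack x) S ⟩
    α x w₁ ℕ.+ (slack x ℕ.+ S) ∎
    where
    open ℕ.≤-Reasoning
    z = lastOf y ys
    S = sum (map slack (y ∷ ys))

sumℤ-map-pred : (f : A → ℕ) (xs : List A) →
  foldr ℤ._+_ (+ 0) (map (λ x → + f x ℤ.- + 1) xs) ≡ + sum (map f xs) ℤ.- + length xs
sumℤ-map-pred f [] = refl
sumℤ-map-pred f (x ∷ xs) = begin
  (+ f x ℤ.- + 1) + foldr ℤ._+_ (+ 0) (map (λ y → + f y ℤ.- + 1) xs)
    ≡⟨ cong (λ w → (+ f x ℤ.- + 1) + w) (sumℤ-map-pred f xs) ⟩
  (+ f x ℤ.- + 1) + (+ sum (map f xs) ℤ.- + length xs)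
    ≡⟨ regroup (+ f x) (+ sum (map f xs)) (+ length xs) ⟩
  (+ f x + + sum (map f xs)) ℤ.- (+ 1 + + length xs)
    ≡⟨ ≡.sym (cong₂ ℤ._-_ (ℤ.pos-+ (f x) _) (ℤ.pos-+ 1 (length xs))) ⟩
  + sum (map f (x ∷ xs)) ℤ.- + length (x ∷ xs) ∎
  where
  open ≡-Reasoning
  regroup : ∀ a s m → (a ℤ.- + 1) + (s ℤ.- m) ≡ (a + s) ℤ.- (+ 1 + m)
  regroup = solve-∀

m+l≤n⇒m≤n-l : ∀ {m l n} → m ℕ.+ l ℕ.≤ n → + m ≤ + n ℤ.- + l
m+l≤n⇒m≤n-l {m} {l} {n} h =
  subst (_≤ + n ℤ.- + l) (cancel (+ m) (+ l))
    (ℤ.+-monoˡ-≤ (ℤ.- + l) (subst (_≤ + n) (ℤ.pos-+ m l) (ℤ.+≤+ h)))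
  where
  cancel : ∀ a b → (a + b) ℤ.- b ≡ a
  cancel = solve-∀

pathWeight-bound : (G : Graph) (u : Fin (n G)) (rest : List (Fin (n G))) (t d : ℕ) →
  t ℕ.+ length (u ∷ rest) ℕ.≤ 1 ℕ.+ d ℕ.+ sum (map (degree G) (u ∷ rest)) →
  + t ≤ + 1 + + d + pathWeight G u rest
pathWeight-bound G u rest t d h = begin
  + t                            ≤⟨ m+l≤n⇒m≤n-l h ⟩
  + (1 ℕ.+ d ℕ.+ S) ℤ.- + L      ≡⟨ cong (ℤ._- + L) (trans (ℤ.pos-+ (1 ℕ.+ d) S) (cong (_+ + S) (ℤ.pos-+ 1 d))) ⟩
  (+ 1 + + d + + S) ℤ.- + L      ≡⟨ shift (+ 1) (+ d) (+ S) (+ L) ⟩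
  + 1 + + d + (+ S ℤ.- + L)      ≡⟨ cong (λ w → + 1 + + d + w) (≡.sym (sumℤ-map-pred (degree G) (u ∷ rest))) ⟩
  + 1 + + d + pathWeight G u rest ∎
  where
  open ℤ.≤-Reasoning
  S = sum (map (degree G) (u ∷ rest))
  L = length (u ∷ rest)
  shift : ∀ a b c e → (a + b + c) ℤ.- e ≡ a + b + (c ℤ.- e)
  shift = solve-∀

path-colour-bound : (G : Graph) {t : ℕ} {α : Fin (n G) → Fin (n G) → ℕ} → ProperColouring G t α →
  ∀ {u v rest w₁ w₂} → IsPath G u v rest → Edge G u w₁ → Edge G v w₂ →
  α v w₂ ℕ.+ length (u ∷ rest) ℕ.≤ α u w₁ ℕ.+ (defG G α ℕ.+ sum (map (degree G) (u ∷ rest)))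
path-colour-bound G {α = α} α-proper {u} {v} {rest} {w₁} {w₂} (chain , unique , refl) e₁ e₂ = begin
  α v w₂ ℕ.+ length P                                             ≤⟨ colour-gap-along G α-proper u rest chain e₁ e₂ ⟩
  α u w₁ ℕ.+ sum (map (slack G α-proper) P)                       ≡⟨ cong (α u w₁ ℕ.+_) (sum-map-+ (defV G α) (degree G) P) ⟩
  α u w₁ ℕ.+ (sum (map (defV G α) P) ℕ.+ sum (map (degree G) P))  ≤⟨ ℕ.+-monoʳ-≤ (α u w₁) (ℕ.+-monoˡ-≤ _ defP≤defG) ⟩
  α u w₁ ℕ.+ (defG G α ℕ.+ sum (map (degree G) P)) ∎
  where
  open ℕ.≤-Reasoning
  P = u ∷ rest
  defP≤defG : sum (map (defV G α) P) ℕ.≤ defG G α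
  defP≤defG = sum-map-mono-⊆ (defV G α) unique (λ {z} _ → ∈-allFin z)

[]-isShortestPath : (G : Graph) (u : Fin (n G)) → IsShortestPath G u u []
[]-isShortestPath G u = (tt , All.[] ∷ [] , refl) , λ _ _ → z≤n

theorem2p2 : (G : Graph) → Connected G → (d : ℕ) → IsDef G d →
    (t : ℕ) (α : Fin (n G) → Fin (n G) → ℕ) → ProperColouring G t α → defG G α ≡ d →
    ∃ λ u → ∃ λ v → ∃ λ (rest : List (Fin (n G))) →
      IsShortestPath G u v rest × (+ t ≤ + 1 + + d + pathWeight G u rest)
theorem2p2 G (n≥1 , _) d _ zero α _ _ =
  u , u , [] , []-isShortestPath G u , pathWeight-bound G u [] 0 d (s≤s z≤n)
  where u = fromℕ< n≥1
theorem2p2 G (_ , connected) d _ (suc t) α α-proper refl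
  with ProperColouring.allUsed α-proper 1 (s≤s z≤n) (s≤s z≤n)
     | ProperColouring.allUsed α-proper (suc t) (s≤s z≤n) ℕ.≤-refl
... | u , w₁ , e₁ , α₁≡1 | v , w₂ , e₂ , α₂≡t with path⇒shortestPath G (proj₂ (connected u v))
... | rest , shortest@(path , _) =
  u , v , rest , shortest , pathWeight-bound G u rest (suc t) (defG G α) colour-bound
  where
  colour-bound : suc t ℕ.+ length (u ∷ rest) ℕ.≤ 1 ℕ.+ defG G α ℕ.+ sum (map (degree G) (u ∷ rest))
  colour-bound = subst₂ (λ c c′ → c ℕ.+ L ℕ.≤ c′ ℕ.+ (defG G α ℕ.+ D)) α₂≡t α₁≡1
    (path-colour-bound G α-proper path e₁ e₂)
    where
    L = length (u ∷ rest)
    D = sum (map (degree G) (u ∷ rest))
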